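{- Let $G=(V,E)$ and $H=(U,W)$ be graphs with adjacency matrices $M$ and $L$. Let $P$ be a perfect coloring of $G$ in $k_1$ colors with parameter matrix $S$, and $R$ a perfect coloring of $H$ in $k_2$ colors with parameter matrix $T$, and let $l_1,\dots,l_{k_2}$ be the numbers of vertices of each color in the coloring $R$. Then $P\otimes R$ is a perfect coloring in $k_1k_2$ colors of the lexicographic product $G\cdot H$ (adjacency matrix $M\otimes J_{|U|}+I_{|V|}\otimes L$) with parameter matrix $$S\otimes\big(J_{k_2}\cdot {\rm diag}(l_1,\dots,l_{k_2})\big)+I_{k_1}\otimes T.$$
   Context: A perfect coloring of a graph with $n$ vertices and adjacency matrix $M$ in $k$ colors is given by an $n\times k$ $(0,1)$-matrix $P$ with exactly one entry $1$ in each row and no zero column (the coloring vertex $\mapsto$ color), such that $MP=PS$ for some $k\times k$ matrix $S$, called the parameter matrix (its entry $s_{i,j}$ is the number of neighbors of color $j$ of any vertex of color $i$). $J_r$ is the $r\times r$ all-ones matrix, $I_r$ the identity matrix, ${\rm diag}$ a diagonal matrix, $\otimes$ the Kronecker product. -}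

module Defs where

open import Data.Nat using (ℕ; zero; suc; _+_; _*_)
open import Data.Fin using (Fin; zero; suc; quotient; remainder; _≟_)
open import Data.Product using (Σ; ∃; _×_; _,_)
open import Data.Sum using (_⊎_)
open import Relation.Nullary using (yes; no)
open import Relation.Binary.PropositionalEquality using (_≡_; _≢_)

Mat : ℕ → ℕ → Set
Mat m n = Fin m → Fin n → ℕ

∑ : (n : ℕ) → (Fin n → ℕ) → ℕ
∑ zero    f = 0
∑ (suc n) f = f zero + ∑ n (λ i → f (suc i))

_·_ : ∀ {m n p} → Mat m n → Mat n p → Mat m p
(_·_ {n = n} A B) i j = ∑ n (λ t → A i t * B t j)

_⊕_ : ∀ {m n} → Mat m n → Mat m n → Mat m n
(A ⊕ B) i j = A i j + B i j

_≐_ : ∀ {m n} → Mat m n → Mat m n → Set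
A ≐ B = ∀ i j → A i j ≡ B i j

-- Kronecker product; row index r : Fin (m * p) corresponds to the pair
-- (quotient p r , remainder p r), i.e. the usual lexicographic block order.
_⊗_ : ∀ {m n p q} → Mat m n → Mat p q → Mat (m * p) (n * q)
(_⊗_ {m} {n} {p} {q} A B) r c =
  A (quotient {m} p r) (quotient {n} q c) * B (remainder {m} p r) (remainder {n} q c)

J : (r : ℕ) → Mat r r
J r i j = 1

I : (r : ℕ) → Mat r r
I r i j with i ≟ j
... | yes _ = 1
... | no  _ = 0

diag : ∀ {r} → (Fin r → ℕ) → Mat r r
diag l i j with i ≟ j
... | yes _ = l i
... | no  _ = 0

IsAdjacencyMatrix : ∀ {n} → Mat n n → Set
IsAdjacencyMatrix M =
  (∀ u v → (M u v ≡ 0) ⊎ (M u v ≡ 1)) ×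
  (∀ u v → M u v ≡ M v u) ×
  (∀ u → M u u ≡ 0)

IsColoringMatrix : ∀ {n k} → Mat n k → Set
IsColoringMatrix {n} {k} P =
  (∀ v c → (P v c ≡ 0) ⊎ (P v c ≡ 1)) ×
  (∀ v → ∃ λ c → (P v c ≡ 1) × (∀ c' → c' ≢ c → P v c' ≡ 0)) ×
  (∀ c → ∃ λ v → P v c ≢ 0)

IsPerfectColoring : ∀ {n k} → Mat n n → Mat n k → Mat k k → Set
IsPerfectColoring M P S = IsColoringMatrix P × ((M · P) ≐ (P · S))

colorCount : ∀ {n k} → Mat n k → Fin k → ℕ
colorCount {n} R c = ∑ n (λ v → R v c)

lexProduct : ∀ {n₁ n₂} → Mat n₁ n₁ → Mat n₂ n₂ → Mat (n₁ * n₂) (n₁ * n₂)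
lexProduct {n₁} {n₂} M L = (M ⊗ J n₂) ⊕ (I n₁ ⊗ L)

module Submission where

-- Writing K = J·diag(l)
-- and using the mixed-product rule (A ⊗ B)(C ⊗ D) = AC ⊗ BD,
--
--   (M ⊗ J + I ⊗ L)(P ⊗ R) = MP ⊗ JR + IP ⊗ LR
--                          = PS ⊗ RK + PI ⊗ RT        (MP = PS, LR = RT)
--                          = (P ⊗ R)(S ⊗ K + I ⊗ T),
--
-- where JR = RK holds because every row of R sums to 1: both sides have
-- all entries of column f equal to the colour count l_f.

open import Defs
open import Data.Nat using (ℕ; zero; suc; _+_; _*_)
open import Data.Nat.Properties
  using (+-*-semiring; +-assoc; +-identityʳ; *-identityˡ; *-identityʳ; *-zeroʳ;
         *-distribˡ-+; *-distribʳ-+; m*n≡0⇒m≡0∨n≡0)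
open import Data.Nat.Solver using (module +-*-Solver)
open import Data.Fin using (Fin; zero; suc; quotient; remainder; combine; _↑ˡ_; _↑ʳ_)
  renaming (_≟_ to _≟ᶠ_)
open import Data.Fin.Properties using (remQuot-combine; combine-remQuot)
open import Data.Product using (∃; _×_; _,_; proj₁; proj₂)
open import Data.Sum using (_⊎_; inj₁; inj₂; [_,_]′)
open import Relation.Nullary using (yes; no; contradiction)
open import Level using (0ℓ)
open import Relation.Binary.Bundles using (Setoid)
open import Relation.Binary.PropositionalEquality
  using (_≡_; _≢_; refl; sym; trans; cong; cong₂; module ≡-Reasoning)
open import Algebra.Properties.Semiring.Sum +-*-semiring
  using (sum; sum-cong-≗; ∑-distrib-+; *-distribˡ-sum; *-distribʳ-sum)

-- The sum ∑ of Defs is the standard library's semiring sum over ℕ; this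
-- lets us reuse the library's congruence and distributivity laws.
∑-as-sum : ∀ n (f : Fin n → ℕ) → ∑ n f ≡ sum f
∑-as-sum zero    f = refl
∑-as-sum (suc n) f = cong (f zero +_) (∑-as-sum n (λ i → f (suc i)))

∑-cong : ∀ n {f g : Fin n → ℕ} → (∀ i → f i ≡ g i) → ∑ n f ≡ ∑ n g
∑-cong n {f} {g} f≗g rewrite ∑-as-sum n f | ∑-as-sum n g = sum-cong-≗ f≗g

∑-+ : ∀ n (f g : Fin n → ℕ) → ∑ n (λ i → f i + g i) ≡ ∑ n f + ∑ n g
∑-+ n f g rewrite ∑-as-sum n (λ i → f i + g i) | ∑-as-sum n f | ∑-as-sum n g =
  ∑-distrib-+ f g

∑-*ˡ : ∀ n c (f : Fin n → ℕ) → ∑ n (λ i → c * f i) ≡ c * ∑ n f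
∑-*ˡ n c f rewrite ∑-as-sum n (λ i → c * f i) | ∑-as-sum n f =
  sym (*-distribˡ-sum c f)

∑-*ʳ : ∀ n c (f : Fin n → ℕ) → ∑ n (λ i → f i * c) ≡ ∑ n f * c
∑-*ʳ n c f rewrite ∑-as-sum n (λ i → f i * c) | ∑-as-sum n f =
  sym (*-distribʳ-sum c f)

∑-separable : ∀ m n (f : Fin m → ℕ) (g : Fin n → ℕ) →
  ∑ m (λ i → ∑ n (λ j → f i * g j)) ≡ ∑ m f * ∑ n g
∑-separable m n f g = begin
  ∑ m (λ i → ∑ n (λ j → f i * g j))  ≡⟨ ∑-cong m (λ i → ∑-*ˡ n (f i) g) ⟩
  ∑ m (λ i → f i * ∑ n g)            ≡⟨ ∑-*ʳ m (∑ n g) f ⟩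
  ∑ m f * ∑ n g                      ∎
  where open ≡-Reasoning

∑-zero : ∀ n (f : Fin n → ℕ) → (∀ i → f i ≡ 0) → ∑ n f ≡ 0
∑-zero zero    f f≡0 = refl
∑-zero (suc n) f f≡0 =
  cong₂ _+_ (f≡0 zero) (∑-zero n (λ i → f (suc i)) (λ i → f≡0 (suc i)))

∑-δ : ∀ n (f : Fin n → ℕ) u → (∀ v → v ≢ u → f v ≡ 0) → ∑ n f ≡ f u
∑-δ (suc n) f zero f≡0 = begin
  f zero + ∑ n (λ i → f (suc i))  ≡⟨ cong (f zero +_) (∑-zero n _ (λ i → f≡0 (suc i) (λ ()))) ⟩
  f zero + 0                      ≡⟨ +-identityʳ (f zero) ⟩
  f zero                          ∎
  where open ≡-Reasoning
∑-δ (suc n) f (suc u) f≡0 = begin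
  f zero + ∑ n (λ i → f (suc i))  ≡⟨ cong (_+ ∑ n (λ i → f (suc i))) (f≡0 zero (λ ())) ⟩
  ∑ n (λ i → f (suc i))           ≡⟨ ∑-δ n (λ i → f (suc i)) u (λ v v≢u → f≡0 (suc v) (λ { refl → v≢u refl })) ⟩
  f (suc u)                       ∎
  where open ≡-Reasoning

∑-++ : ∀ m n (f : Fin (m + n) → ℕ) →
  ∑ (m + n) f ≡ ∑ m (λ i → f (i ↑ˡ n)) + ∑ n (λ j → f (m ↑ʳ j))
∑-++ zero    n f = refl
∑-++ (suc m) n f = begin
  f zero + ∑ (m + n) (λ i → f (suc i))
    ≡⟨ cong (f zero +_) (∑-++ m n (λ i → f (suc i))) ⟩
  f zero + (∑ m (λ i → f (suc (i ↑ˡ n))) + ∑ n (λ j → f (suc m ↑ʳ j)))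
    ≡⟨ +-assoc (f zero) _ _ ⟨
  f zero + ∑ m (λ i → f (suc (i ↑ˡ n))) + ∑ n (λ j → f (suc m ↑ʳ j))
    ∎
  where open ≡-Reasoning

∑-combine : ∀ m n (f : Fin (m * n) → ℕ) →
  ∑ (m * n) f ≡ ∑ m (λ i → ∑ n (λ j → f (combine i j)))
∑-combine zero    n f = refl
∑-combine (suc m) n f =
  trans (∑-++ n (m * n) f)
        (cong (∑ n (λ j → f (j ↑ˡ (m * n))) +_) (∑-combine m n (λ t → f (n ↑ʳ t))))

≐-sym : ∀ {m n} {A B : Mat m n} → A ≐ B → B ≐ A
≐-sym A≐B i j = sym (A≐B i j)

≐-trans : ∀ {m n} {A B C : Mat m n} → A ≐ B → B ≐ C → A ≐ C
≐-trans A≐B B≐C i j = trans (A≐B i j) (B≐C i j)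

Mat-setoid : ℕ → ℕ → Setoid 0ℓ 0ℓ
Mat-setoid m n = record
  { Carrier       = Mat m n
  ; _≈_           = _≐_
  ; isEquivalence = record
    { refl  = λ i j → refl
    ; sym   = ≐-sym
    ; trans = ≐-trans
    }
  }

⊕-cong : ∀ {m n} {A A′ B B′ : Mat m n} → A ≐ A′ → B ≐ B′ → (A ⊕ B) ≐ (A′ ⊕ B′)
⊕-cong A≐A′ B≐B′ i j = cong₂ _+_ (A≐A′ i j) (B≐B′ i j)

⊗-cong : ∀ {m n p q} {A A′ : Mat m n} {B B′ : Mat p q} →
  A ≐ A′ → B ≐ B′ → (A ⊗ B) ≐ (A′ ⊗ B′)
⊗-cong {m} {n} {p} {q} A≐A′ B≐B′ r c =
  cong₂ _*_ (A≐A′ (quotient {m} p r) (quotient {n} q c))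
            (B≐B′ (remainder {m} p r) (remainder {n} q c))

·-distribʳ-⊕ : ∀ {m n p} (A B : Mat m n) (C : Mat n p) → ((A ⊕ B) · C) ≐ ((A · C) ⊕ (B · C))
·-distribʳ-⊕ {n = n} A B C i j =
  trans (∑-cong n (λ t → *-distribʳ-+ (C t j) (A i t) (B i t)))
        (∑-+ n (λ t → A i t * C t j) (λ t → B i t * C t j))

·-distribˡ-⊕ : ∀ {m n p} (A : Mat m n) (B C : Mat n p) → (A · (B ⊕ C)) ≐ ((A · B) ⊕ (A · C))
·-distribˡ-⊕ {n = n} A B C i j =
  trans (∑-cong n (λ t → *-distribˡ-+ (A i t) (B t j) (C t j)))
        (∑-+ n (λ t → A i t * B t j) (λ t → A i t * C t j))

diag-on : ∀ {r} (l : Fin r → ℕ) i → diag l i i ≡ l i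
diag-on l i with i ≟ᶠ i
... | yes _   = refl
... | no  i≢i = contradiction refl i≢i

diag-off : ∀ {r} (l : Fin r → ℕ) {i j} → i ≢ j → diag l i j ≡ 0
diag-off l {i} {j} i≢j with i ≟ᶠ j
... | yes i≡j = contradiction i≡j i≢j
... | no  _   = refl

I≐diag : ∀ r → I r ≐ diag (λ _ → 1)
I≐diag r i j with i ≟ᶠ j
... | yes _ = refl
... | no  _ = refl

∑-diagˡ : ∀ {r} (l : Fin r → ℕ) i (f : Fin r → ℕ) → ∑ r (λ t → diag l i t * f t) ≡ l i * f i
∑-diagˡ {r} l i f =
  trans (∑-δ r _ i (λ t t≢i → cong (_* f t) (diag-off l (λ i≡t → t≢i (sym i≡t)))))
        (cong (_* f i) (diag-on l i))

∑-diagʳ : ∀ {r} (l : Fin r → ℕ) j (f : Fin r → ℕ) → ∑ r (λ t → f t * diag l t j) ≡ f j * l j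
∑-diagʳ {r} l j f =
  trans (∑-δ r _ j (λ t t≢j → trans (cong (f t *_) (diag-off l t≢j)) (*-zeroʳ (f t))))
        (cong (f j *_) (diag-on l j))

·-identityˡ : ∀ {m n} (A : Mat m n) → (I m · A) ≐ A
·-identityˡ {m} A i j =
  trans (∑-cong m (λ t → cong (_* A t j) (I≐diag m i t)))
        (trans (∑-diagˡ (λ _ → 1) i (λ t → A t j)) (*-identityˡ (A i j)))

·-identityʳ : ∀ {m n} (A : Mat m n) → (A · I n) ≐ A
·-identityʳ {n = n} A i j =
  trans (∑-cong n (λ t → cong (A i t *_) (I≐diag n t j)))
        (trans (∑-diagʳ (λ _ → 1) j (A i)) (*-identityʳ (A i j)))

J·diag : ∀ {r} (l : Fin r → ℕ) → (J r · diag l) ≐ (λ _ f → l f)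
J·diag l g f = trans (∑-diagʳ l f (λ _ → 1)) (*-identityˡ (l f))

quotient-combine : ∀ {m n} (i : Fin m) (j : Fin n) → quotient {m} n (combine i j) ≡ i
quotient-combine i j = cong proj₁ (remQuot-combine i j)

remainder-combine : ∀ {m n} (i : Fin m) (j : Fin n) → remainder {m} n (combine i j) ≡ j
remainder-combine i j = cong proj₂ (remQuot-combine i j)

⊗-combine : ∀ {m n p q} (A : Mat m n) (B : Mat p q) i j e f →
  (A ⊗ B) (combine i j) (combine e f) ≡ A i e * B j f
⊗-combine A B i j e f =
  cong₂ _*_ (cong₂ A (quotient-combine i j) (quotient-combine e f))
            (cong₂ B (remainder-combine i j) (remainder-combine e f))

interchange : ∀ a b c d → (a * b) * (c * d) ≡ (a * c) * (b * d)
interchange a b c d = solve 4 (λ a b c d → (a :* b) :* (c :* d) := (a :* c) :* (b :* d)) refl a b c d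
  where open +-*-Solver

-- The mixed-product rule (A ⊗ B)(C ⊗ D) = AC ⊗ BD: split the inner index
-- of the product into its block pair (e , f) and factor the double sum.
⊗-mixed-product : ∀ {m n p q s t} (A : Mat m n) (B : Mat p q) (C : Mat n s) (D : Mat q t) →
  ((A ⊗ B) · (C ⊗ D)) ≐ ((A · C) ⊗ (B · D))
⊗-mixed-product {m} {n} {p} {q} {s} {t} A B C D r c = begin
  ∑ (n * q) (λ k → (A ⊗ B) r k * (C ⊗ D) k c)
    ≡⟨ ∑-combine n q _ ⟩
  ∑ n (λ e → ∑ q (λ f → (A ⊗ B) r (combine e f) * (C ⊗ D) (combine e f) c))
    ≡⟨ ∑-cong n (λ e → ∑-cong q (λ f → cong₂ (λ x y → (A ⊗ B) x (combine e f) * (C ⊗ D) (combine e f) y)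
                                              (combine-remQuot {m} p r) (combine-remQuot {s} t c))) ⟨
  ∑ n (λ e → ∑ q (λ f → (A ⊗ B) (combine u x) (combine e f) * (C ⊗ D) (combine e f) (combine a b)))
    ≡⟨ ∑-cong n (λ e → ∑-cong q (λ f → cong₂ _*_ (⊗-combine A B u x e f) (⊗-combine C D e f a b))) ⟩
  ∑ n (λ e → ∑ q (λ f → (A u e * B x f) * (C e a * D f b)))
    ≡⟨ ∑-cong n (λ e → ∑-cong q (λ f → interchange (A u e) (B x f) (C e a) (D f b))) ⟩
  ∑ n (λ e → ∑ q (λ f → (A u e * C e a) * (B x f * D f b)))
    ≡⟨ ∑-separable n q (λ e → A u e * C e a) (λ f → B x f * D f b) ⟩
  (A · C) u a * (B · D) x b
    ∎
  where
  open ≡-Reasoning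
  u : Fin m
  u = quotient {m} p r
  x : Fin p
  x = remainder {m} p r
  a : Fin s
  a = quotient {s} t c
  b : Fin t
  b = remainder {s} t c

row-sum : ∀ {n k} (R : Mat n k) → IsColoringMatrix R → ∀ v → ∑ k (R v) ≡ 1
row-sum {k = k} R (_ , one-per-row , _) v =
  let (c , Rvc≡1 , others≡0) = one-per-row v in trans (∑-δ k (R v) c others≡0) Rvc≡1

-- J R = R (J·diag(l)): the column sums of R, spread over all rows.
J·coloring : ∀ {n k} (R : Mat n k) → IsColoringMatrix R →
  (J n · R) ≐ (R · (J k · diag (colorCount R)))
J·coloring {n} {k} R isColoring v f = begin
  ∑ n (λ w → 1 * R w f)                               ≡⟨ ∑-cong n (λ w → *-identityˡ (R w f)) ⟩
  colorCount R f                                      ≡⟨ *-identityˡ (colorCount R f) ⟨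
  1 * colorCount R f                                  ≡⟨ cong (_* colorCount R f) (row-sum R isColoring v) ⟨
  ∑ k (R v) * colorCount R f                          ≡⟨ ∑-*ʳ k (colorCount R f) (R v) ⟨
  ∑ k (λ g → R v g * colorCount R f)                  ≡⟨ ∑-cong k (λ g → cong (R v g *_) (J·diag (colorCount R) g f)) ⟨
  ∑ k (λ g → R v g * (J k · diag (colorCount R)) g f) ∎
  where open ≡-Reasoning

*-01 : ∀ {a b} → (a ≡ 0) ⊎ (a ≡ 1) → (b ≡ 0) ⊎ (b ≡ 1) → (a * b ≡ 0) ⊎ (a * b ≡ 1)
*-01 (inj₁ refl) _           = inj₁ refl
*-01 (inj₂ refl) (inj₁ refl) = inj₁ refl
*-01 (inj₂ refl) (inj₂ refl) = inj₂ refl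

*-zero-factor : ∀ {a b} → (a ≡ 0) ⊎ (b ≡ 0) → a * b ≡ 0
*-zero-factor     (inj₁ refl) = refl
*-zero-factor {a} (inj₂ refl) = *-zeroʳ a

-- The Kronecker product of two coloring matrices is a coloring matrix:
-- vertex (v , w) receives the colour (colour of v , colour of w).
⊗-coloring : ∀ {n₁ k₁ n₂ k₂} (P : Mat n₁ k₁) (R : Mat n₂ k₂) →
  IsColoringMatrix P → IsColoringMatrix R → IsColoringMatrix (P ⊗ R)
⊗-coloring {n₁} {k₁} {n₂} {k₂} P R (P01 , P-row , P-col) (R01 , R-row , R-col) =
  (λ v c → *-01 (P01 _ _) (R01 _ _)) , one-per-row , nonzero-columns
  where
  one-per-row : ∀ v → ∃ λ c → ((P ⊗ R) v c ≡ 1) × (∀ c′ → c′ ≢ c → (P ⊗ R) v c′ ≡ 0)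
  one-per-row v with P-row (quotient {n₁} n₂ v) | R-row (remainder {n₁} n₂ v)
  ... | a , Pa≡1 , P-others | b , Rb≡1 , R-others =
    combine a b , entry≡1 , others≡0
    where
    v₁ : Fin n₁
    v₁ = quotient {n₁} n₂ v
    v₂ : Fin n₂
    v₂ = remainder {n₁} n₂ v

    entry≡1 : (P ⊗ R) v (combine a b) ≡ 1
    entry≡1 = trans (cong₂ (λ a′ b′ → P v₁ a′ * R v₂ b′)
                           (quotient-combine a b) (remainder-combine a b))
                    (cong₂ _*_ Pa≡1 Rb≡1)

    others≡0 : ∀ c′ → c′ ≢ combine a b → (P ⊗ R) v c′ ≡ 0
    others≡0 c′ c′≢ab with quotient {k₁} k₂ c′ ≟ᶠ a | remainder {k₁} k₂ c′ ≟ᶠ b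
    ... | no  a′≢a | _        = *-zero-factor (inj₁ (P-others _ a′≢a))
    ... | yes _    | no  b′≢b = *-zero-factor {P v₁ (quotient {k₁} k₂ c′)} (inj₂ (R-others _ b′≢b))
    ... | yes a′≡a | yes b′≡b =
      contradiction (trans (sym (combine-remQuot {k₁} k₂ c′)) (cong₂ combine a′≡a b′≡b)) c′≢ab

  nonzero-columns : ∀ c → ∃ λ v → (P ⊗ R) v c ≢ 0
  nonzero-columns c with P-col (quotient {k₁} k₂ c) | R-col (remainder {k₁} k₂ c)
  ... | v , Pv≢0 | w , Rw≢0 = combine v w , entry≢0
    where
    entry : (P ⊗ R) (combine v w) c ≡ P v (quotient {k₁} k₂ c) * R w (remainder {k₁} k₂ c)
    entry = cong₂ (λ v′ w′ → P v′ (quotient {k₁} k₂ c) * R w′ (remainder {k₁} k₂ c))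
                  (quotient-combine v w) (remainder-combine v w)

    entry≢0 : (P ⊗ R) (combine v w) c ≢ 0
    entry≢0 PR≡0 = [ Pv≢0 , Rw≢0 ]′ (m*n≡0⇒m≡0∨n≡0 _ (trans (sym entry) PR≡0))

theorem19 : (n₁ n₂ k₁ k₂ : ℕ)
    (M : Mat n₁ n₁) (L : Mat n₂ n₂)
    (P : Mat n₁ k₁) (S : Mat k₁ k₁)
    (R : Mat n₂ k₂) (T : Mat k₂ k₂) →
    IsAdjacencyMatrix M → IsAdjacencyMatrix L →
    IsPerfectColoring M P S → IsPerfectColoring L R T →
    IsPerfectColoring (lexProduct M L) (P ⊗ R)
    ((S ⊗ (J k₂ · diag (colorCount R))) ⊕ (I k₁ ⊗ T))
theorem19 n₁ n₂ k₁ k₂ M L P S R T _ _ (P-coloring , MP≐PS) (R-coloring , LR≐RT) =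
  ⊗-coloring P R P-coloring R-coloring , equitable
  where
  open import Relation.Binary.Reasoning.Setoid (Mat-setoid (n₁ * n₂) (k₁ * k₂))
  K : Mat k₂ k₂
  K = J k₂ · diag (colorCount R)

  IP≐PI : (I n₁ · P) ≐ (P · I k₁)
  IP≐PI = ≐-trans (·-identityˡ P) (≐-sym (·-identityʳ P))

  equitable : (lexProduct M L · (P ⊗ R)) ≐ ((P ⊗ R) · ((S ⊗ K) ⊕ (I k₁ ⊗ T)))
  equitable = begin
    ((M ⊗ J n₂) ⊕ (I n₁ ⊗ L)) · (P ⊗ R)
      ≈⟨ ·-distribʳ-⊕ (M ⊗ J n₂) (I n₁ ⊗ L) (P ⊗ R) ⟩
    ((M ⊗ J n₂) · (P ⊗ R)) ⊕ ((I n₁ ⊗ L) · (P ⊗ R))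
      ≈⟨ ⊕-cong (⊗-mixed-product M (J n₂) P R) (⊗-mixed-product (I n₁) L P R) ⟩
    ((M · P) ⊗ (J n₂ · R)) ⊕ ((I n₁ · P) ⊗ (L · R))
      ≈⟨ ⊕-cong (⊗-cong MP≐PS (J·coloring R R-coloring)) (⊗-cong IP≐PI LR≐RT) ⟩
    ((P · S) ⊗ (R · K)) ⊕ ((P · I k₁) ⊗ (R · T))
      ≈⟨ ⊕-cong (⊗-mixed-product P R S K) (⊗-mixed-product P R (I k₁) T) ⟨
    ((P ⊗ R) · (S ⊗ K)) ⊕ ((P ⊗ R) · (I k₁ ⊗ T))
      ≈⟨ ·-distribˡ-⊕ (P ⊗ R) (S ⊗ K) (I k₁ ⊗ T) ⟨
    (P ⊗ R) · ((S ⊗ K) ⊕ (I k₁ ⊗ T))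
      ∎
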